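{- The Karoubi envelope $\mathrm{Split}(\mathsf{SEnt})$ is dually equivalent to the category $\mathsf{ContLat_{Scott}}$ of continuous lattices and Scott continuous functions.
   Context: Work constructively; $\mathrm{Fin}(S)$ is the set of finitely enumerable subsets of $S$. For sets $S,S'$, a relation $r\subseteq S\times\mathrm{Fin}(S')$ is upper if $a\,r\,B\Rightarrow a\,r\,(B\cup B')$. For upper relations $r\subseteq S\times\mathrm{Fin}(S')$ and $s\subseteq S'\times\mathrm{Fin}(S'')$, the cut composition $s\cdot r\subseteq S\times\mathrm{Fin}(S'')$ is $a\,(s\cdot r)\,C\iff\exists B\in\mathrm{Fin}(S')\,(a\,r\,B\ \&\ \forall b\in B\,(b\,s\,C))$. $\mathsf{SEnt}$ is the category whose objects are sets and whose morphisms $S\to S'$ are upper relations $S\times\mathrm{Fin}(S')$, with identity the membership relation $\in$ and composition cut composition. The Karoubi envelope $\mathrm{Split}(\mathcal C)$ has as objects the idempotents $f:A\to A$ of $\mathcal C$ and as morphisms $(f:A\to A)\to(g:B\to B)$ the $h:A\to B$ with $g\circ h=h=h\circ f$. A continuous lattice is a continuous domain with finite joins. Dually equivalent means equivalent to the opposite category. -}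

module Defs where

open import Level using (Level; _⊔_) renaming (suc to lsuc)
open import Data.Product using (Σ; _×_; _,_; proj₁; proj₂)
open import Data.List using (List; []; _∷_; [_]; _++_)
open import Data.List.Membership.Propositional using (_∈_)
open import Data.List.Membership.Propositional.Properties using (∈-++⁺ˡ; ∈-++⁺ʳ)
open import Data.List.Relation.Binary.Subset.Propositional using (_⊆_)
open import Data.List.Relation.Unary.Any using (here)
open import Data.List.Relation.Unary.All as All using (All; []; _∷_)
open import Data.List.Relation.Unary.All.Properties as AllP using ()
open import Relation.Binary.PropositionalEquality using (refl)
open import Function using (_∘′_)

record Category (o h e : Level) : Set (lsuc (o ⊔ h ⊔ e)) where
  infixr 9 _∘_
  infix 4 _≈_
  field
    Obj   : Set o
    Hom   : Obj → Obj → Set h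
    _≈_   : ∀ {A B} → Hom A B → Hom A B → Set e
    ≈-refl  : ∀ {A B} {f : Hom A B} → f ≈ f
    ≈-sym   : ∀ {A B} {f g : Hom A B} → f ≈ g → g ≈ f
    ≈-trans : ∀ {A B} {f g k : Hom A B} → f ≈ g → g ≈ k → f ≈ k
    id    : ∀ {A} → Hom A A
    _∘_   : ∀ {A B C} → Hom B C → Hom A B → Hom A C
    ∘-resp-≈ : ∀ {A B C} {f f' : Hom B C} {g g' : Hom A B} →
               f ≈ f' → g ≈ g' → f ∘ g ≈ f' ∘ g'
    assoc : ∀ {A B C D} {f : Hom A B} {g : Hom B C} {k : Hom C D} →
            (k ∘ g) ∘ f ≈ k ∘ (g ∘ f)
    identityˡ : ∀ {A B} {f : Hom A B} → id ∘ f ≈ f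
    identityʳ : ∀ {A B} {f : Hom A B} → f ∘ id ≈ f

op : ∀ {o h e} → Category o h e → Category o h e
op C = record
  { Obj = Obj ; Hom = λ A B → Hom B A ; _≈_ = _≈_
  ; ≈-refl = ≈-refl ; ≈-sym = ≈-sym ; ≈-trans = ≈-trans
  ; id = id ; _∘_ = λ f g → g ∘ f
  ; ∘-resp-≈ = λ p q → ∘-resp-≈ q p
  ; assoc = ≈-sym assoc ; identityˡ = identityʳ ; identityʳ = identityˡ }
  where open Category C

record Functor {o h e o' h' e'} (C : Category o h e) (D : Category o' h' e')
       : Set (o ⊔ h ⊔ e ⊔ o' ⊔ h' ⊔ e') where
  private
    module C = Category C
    module D = Category D
  field
    F₀ : C.Obj → D.Obj
    F₁ : ∀ {A B} → C.Hom A B → D.Hom (F₀ A) (F₀ B)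
    F-resp-≈ : ∀ {A B} {f g : C.Hom A B} → f C.≈ g → F₁ f D.≈ F₁ g
    F-id : ∀ {A} → F₁ (C.id {A}) D.≈ D.id
    F-∘  : ∀ {A B K} {f : C.Hom A B} {g : C.Hom B K} →
           F₁ (g C.∘ f) D.≈ F₁ g D.∘ F₁ f

record Iso {o h e} (C : Category o h e) (A B : Category.Obj C) : Set (h ⊔ e) where
  open Category C
  field
    to   : Hom A B
    from : Hom B A
    from∘to : from ∘ to ≈ id
    to∘from : to ∘ from ≈ id

record IsEquivalence {o h e o' h' e'} {C : Category o h e} {D : Category o' h' e'}
       (F : Functor C D) : Set (o ⊔ h ⊔ e ⊔ o' ⊔ h' ⊔ e') where
  private
    module C = Category C
    module D = Category D
  open Functor F
  field
    full     : ∀ {A B} (g : D.Hom (F₀ A) (F₀ B)) → Σ (C.Hom A B) λ f → F₁ f D.≈ g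
    faithful : ∀ {A B} (f g : C.Hom A B) → F₁ f D.≈ F₁ g → f C.≈ g
    essSurj  : ∀ (Y : D.Obj) → Σ C.Obj λ X → Iso D (F₀ X) Y

Equivalent : ∀ {o h e o' h' e'} → Category o h e → Category o' h' e' →
             Set (o ⊔ h ⊔ e ⊔ o' ⊔ h' ⊔ e')
Equivalent C D = Σ (Functor C D) IsEquivalence

DuallyEquivalent : ∀ {o h e o' h' e'} → Category o h e → Category o' h' e' →
                   Set (o ⊔ h ⊔ e ⊔ o' ⊔ h' ⊔ e')
DuallyEquivalent C D = Equivalent (op C) D

-- Fin(S) is represented by List S (finite enumerations); a
-- relation on Fin(S') must be upper, which for lists we state as
-- monotonicity along ⊆ (this also makes it invariant under re-enumeration).

record UpRel (S S' : Set) : Set₁ where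
  field
    rel   : S → List S' → Set
    upper : ∀ {a B C} → rel a B → B ⊆ C → rel a C
open UpRel public

infix 4 _≈R_
_≈R_ : ∀ {S S'} → UpRel S S' → UpRel S S' → Set
r ≈R r' = ∀ a B → (rel r a B → rel r' a B) × (rel r' a B → rel r a B)

idR : ∀ {S} → UpRel S S
idR = record { rel = λ a B → a ∈ B ; upper = λ p q → q p }

infixr 9 _·_
_·_ : ∀ {S S' S''} → UpRel S' S'' → UpRel S S' → UpRel S S''
s · r = record
  { rel = λ a C → Σ (List _) λ B → rel r a B × All (λ b → rel s b C) B
  ; upper = λ { (B , p , q) C⊆D → B , p , All.map (λ x → upper s x C⊆D) q } }

private
  ≈R-refl : ∀ {S S'} {r : UpRel S S'} → r ≈R r
  ≈R-refl a B = (λ x → x) , (λ x → x)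

  ≈R-sym : ∀ {S S'} {r r' : UpRel S S'} → r ≈R r' → r' ≈R r
  ≈R-sym p a B = proj₂ (p a B) , proj₁ (p a B)

  ≈R-trans : ∀ {S S'} {r r' r'' : UpRel S S'} → r ≈R r' → r' ≈R r'' → r ≈R r''
  ≈R-trans p q a B = (λ x → proj₁ (q a B) (proj₁ (p a B) x))
                   , (λ x → proj₂ (p a B) (proj₂ (q a B) x))

  ·-resp : ∀ {S S' S''} {s s' : UpRel S' S''} {r r' : UpRel S S'} →
           s ≈R s' → r ≈R r' → s · r ≈R s' · r'
  ·-resp {s = s} {s'} ps pr a C =
      (λ { (B , x , q) → B , proj₁ (pr a B) x , All.map (λ {b} y → proj₁ (ps b C) y) q })
    , (λ { (B , x , q) → B , proj₂ (pr a B) x , All.map (λ {b} y → proj₂ (ps b C) y) q })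

  collect : ∀ {S' S'' S'''} (s : UpRel S' S'') (t : UpRel S'' S''') {D B} →
            All (λ b → Σ (List S'') λ C → rel s b C × All (λ c → rel t c D) C) B →
            Σ (List S'') λ C → All (λ b → rel s b C) B × All (λ c → rel t c D) C
  collect s t [] = [] , [] , []
  collect s t ((C₁ , x , y) ∷ q) with collect s t q
  ... | C₂ , u , v = C₁ ++ C₂
                   , upper s x (∈-++⁺ˡ) ∷ All.map (λ z → upper s z (∈-++⁺ʳ C₁)) u
                   , AllP.++⁺ y v

  ·-assoc : ∀ {S S' S'' S'''} {r : UpRel S S'} {s : UpRel S' S''} {t : UpRel S'' S'''} →
            (t · s) · r ≈R t · (s · r)
  ·-assoc {r = r} {s} {t} a D =
      (λ { (B , p , q) → let (C , u , v) = collect s t q in C , (B , p , u) , v })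
    , (λ { (C , (B , p , q) , w) → B , p , All.map (λ x → C , x , w) q })

  ·-idˡ : ∀ {S S'} {r : UpRel S S'} → idR · r ≈R r
  ·-idˡ {r = r} a C = (λ { (B , p , q) → upper r p (All.lookup q) })
                    , (λ p → C , p , All.tabulate (λ x → x))

  ·-idʳ : ∀ {S S'} {r : UpRel S S'} → r · idR ≈R r
  ·-idʳ {r = r} a C = (λ { (B , p , q) → All.lookup q p })
                    , (λ p → [ a ] , here refl , p ∷ [])

SEnt : Category (lsuc Level.zero) (lsuc Level.zero) Level.zero
SEnt = record
  { Obj = Set ; Hom = UpRel ; _≈_ = _≈R_
  ; ≈-refl = λ {A} {B} {f} → ≈R-refl {r = f}
  ; ≈-sym = λ {A} {B} {f} {g} → ≈R-sym {r = f} {g}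
  ; ≈-trans = λ {A} {B} {f} {g} {k} → ≈R-trans {r = f} {g} {k}
  ; id = idR ; _∘_ = _·_
  ; ∘-resp-≈ = λ {A} {B} {C} {f} {f'} {g} {g'} → ·-resp {s = f} {f'} {g} {g'}
  ; assoc = λ {A} {B} {C} {D} {f} {g} {k} → ·-assoc {r = f} {g} {k}
  ; identityˡ = λ {A} {B} {f} → ·-idˡ {r = f}
  ; identityʳ = λ {A} {B} {f} → ·-idʳ {r = f} }

module _ {o h e} (C : Category o h e) where
  open Category C

  record Idempotent : Set (o ⊔ h ⊔ e) where
    field
      obj  : Obj
      idem : Hom obj obj
      isIdem : idem ∘ idem ≈ idem

  record SplitHom (X Y : Idempotent) : Set (h ⊔ e) where
    private
      module X = Idempotent X
      module Y = Idempotent Y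
    field
      hom   : Hom X.obj Y.obj
      left  : Y.idem ∘ hom ≈ hom
      right : hom ∘ X.idem ≈ hom
  open SplitHom

  Split : Category (o ⊔ h ⊔ e) (h ⊔ e) e
  Split = record
    { Obj = Idempotent
    ; Hom = SplitHom
    ; _≈_ = λ f g → hom f ≈ hom g
    ; ≈-refl = ≈-refl ; ≈-sym = ≈-sym ; ≈-trans = ≈-trans
    ; id = λ {X} → record { hom = Idempotent.idem X
                          ; left = Idempotent.isIdem X ; right = Idempotent.isIdem X }
    ; _∘_ = λ {X} {Y} {Z} k f → record
        { hom = hom k ∘ hom f
        ; left = ≈-trans (≈-sym assoc) (∘-resp-≈ (left k) ≈-refl)
        ; right = ≈-trans assoc (∘-resp-≈ ≈-refl (right f)) }
    ; ∘-resp-≈ = ∘-resp-≈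
    ; assoc = assoc
    ; identityˡ = λ {X} {Y} {f} → left f
    ; identityʳ = λ {X} {Y} {f} → right f }

-- Continuous lattices.
-- Carrier in Set₁ (e.g. lattices of subsets of a set), order Set-valued,
-- equality = mutual ≤ (so antisymmetry holds by definition).

record DLat : Set₂ where
  infix 4 _≤_ _≈_
  field
    L     : Set₁
    _≤_   : L → L → Set
    ≤-refl  : ∀ {x} → x ≤ x
    ≤-trans : ∀ {x y z} → x ≤ y → y ≤ z → x ≤ z

  _≈_ : L → L → Set
  x ≈ y = x ≤ y × y ≤ x

  Directed : (I : Set) → (I → L) → Set
  Directed I D = I × (∀ i j → Σ I λ k → D i ≤ D k × D j ≤ D k)

  field
    ⋁       : (I : Set) (D : I → L) → Directed I D → L
    ⋁-ub    : ∀ {I D} (d : Directed I D) i → D i ≤ ⋁ I D d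
    ⋁-least : ∀ {I D} (d : Directed I D) u → (∀ i → D i ≤ u) → ⋁ I D d ≤ u
    ⊥      : L
    ⊥-least : ∀ x → ⊥ ≤ x
    _∨_    : L → L → L
    ∨-ubˡ  : ∀ x y → x ≤ x ∨ y
    ∨-ubʳ  : ∀ x y → y ≤ x ∨ y
    ∨-least : ∀ x y u → x ≤ u → y ≤ u → x ∨ y ≤ u

  _≪_ : L → L → Set₁
  x ≪ y = ∀ (I : Set) (D : I → L) (d : Directed I D) → y ≤ ⋁ I D d →
          Σ I λ i → x ≤ D i

-- A continuous lattice: a dcpo with finite joins which is continuous,
-- witnessed (predicatively) by a set-sized basis B with a Set-valued
-- presentation ≺ of way-below on basis elements, such that every x is the
-- directed join of the basis elements way below it.
record ContLattice : Set₂ where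
  field
    dlat : DLat
  open DLat dlat public
  field
    Basis : Set
    β     : Basis → L
    _≺_   : Basis → L → Set
    ≺⇒≪  : ∀ {b x} → b ≺ x → β b ≪ x
    ≪⇒≺  : ∀ {b x} → β b ≪ x → b ≺ x
    approx-dir : ∀ x → Directed (Σ Basis λ b → b ≺ x) (λ p → β (proj₁ p))
    approx     : ∀ x → ⋁ _ _ (approx-dir x) ≈ x

module _ (A B : ContLattice) where
  private
    module A = ContLattice A
    module B = ContLattice B

  Monotone : (A.L → B.L) → Set₁
  Monotone f = ∀ {x y} → x A.≤ y → f x B.≤ f y

  mapDir : ∀ {f} → Monotone f → ∀ {I D} → A.Directed I D → B.Directed I (λ i → f (D i))
  mapDir m (i₀ , up) = i₀ , λ i j → let (k , p , q) = up i j in k , m p , m q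

  record ScottCont : Set₁ where
    field
      fun  : A.L → B.L
      mono : Monotone fun
      pres-⋁ : ∀ {I D} (d : A.Directed I D) →
               fun (A.⋁ I D d) B.≤ B.⋁ I (λ i → fun (D i)) (mapDir mono d)

open ScottCont

private
  ⋁-irr : (A : ContLattice) → let open ContLattice A in
          ∀ {I D} (d d' : Directed I D) → ⋁ I D d ≤ ⋁ I D d'
  ⋁-irr A d d' = ⋁-least d _ (⋁-ub d') where open ContLattice A

  idSC : ∀ {A} → ScottCont A A
  idSC {A} = record { fun = λ x → x ; mono = λ p → p
                    ; pres-⋁ = λ d → ⋁-irr A d _ }

  _∘SC_ : ∀ {A B C} → ScottCont B C → ScottCont A B → ScottCont A C
  _∘SC_ {A} {B} {C} g f = record
    { fun = λ x → fun g (fun f x)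
    ; mono = λ p → mono g (mono f p)
    ; pres-⋁ = λ d → C.≤-trans (mono g (pres-⋁ f d))
                   (C.≤-trans (pres-⋁ g (mapDir A B (mono f) d)) (⋁-irr C _ _)) }
    where module C = ContLattice C

ContLatScott : Category (lsuc (lsuc Level.zero)) (lsuc Level.zero) (lsuc Level.zero)
ContLatScott = record
  { Obj = ContLattice
  ; Hom = ScottCont
  ; _≈_ = λ {A} {B} f g → ∀ x → ContLattice._≈_ B (fun f x) (fun g x)
  ; ≈-refl = λ {A} {B} x → ContLattice.≤-refl B , ContLattice.≤-refl B
  ; ≈-sym = λ p x → proj₂ (p x) , proj₁ (p x)
  ; ≈-trans = λ {A} {B} p q x → ContLattice.≤-trans B (proj₁ (p x)) (proj₁ (q x))
                              , ContLattice.≤-trans B (proj₂ (q x)) (proj₂ (p x))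
  ; id = idSC
  ; _∘_ = _∘SC_
  ; ∘-resp-≈ = λ {A} {B} {C} {f} {f'} {g} {g'} p q x →
      ContLattice.≤-trans C (mono f (proj₁ (q x))) (proj₁ (p (fun g' x)))
    , ContLattice.≤-trans C (proj₂ (p (fun g' x))) (mono f (proj₂ (q x)))
  ; assoc = λ {D = D} x → ContLattice.≤-refl D , ContLattice.≤-refl D
  ; identityˡ = λ {B = B} x → ContLattice.≤-refl B , ContLattice.≤-refl B
  ; identityʳ = λ {B = B} x → ContLattice.≤-refl B , ContLattice.≤-refl B }

-- An idempotent e on S acts on predicates by U ↦ ⟦ e ⟧ U, the points that e-entail a
-- finite part of U. Predicates up to this action form a continuous lattice whose basis
-- is the finite subsets of S, and a morphism of idempotents acts contravariantly as a
-- Scott continuous map. Conversely a Scott continuous φ is recovered from the relation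
-- b ⊢ C :⇔ b ∈ φ(C), since every predicate is the directed join of its finite subsets;
-- and every continuous lattice arises from the idempotent on its basis given by the
-- way-below relation.
module Submission where

open import Level using (0ℓ)
open import Data.Product using (Σ; ∃; _×_; _,_; proj₁; proj₂; swap)
open import Data.Sum using (inj₁; inj₂)
open import Data.Unit using (⊤; tt)
open import Data.List using (List; []; _∷_; [_]; _++_)
open import Data.List.Membership.Propositional using (_∈_)
open import Data.List.Membership.Propositional.Properties using (∈-++⁺ˡ; ∈-++⁺ʳ)
open import Data.List.Relation.Unary.Any using (here; there)
open import Data.List.Relation.Unary.All as All using (All; []; _∷_)
open import Data.List.Relation.Unary.All.Properties using (++⁺)
open import Relation.Binary.PropositionalEquality using (refl)
open import Relation.Unary using (Pred; _⊆_; _≐_; ∅; _∪_; ⋃)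

open import Defs

⟦_⟧ : ∀ {S S'} → UpRel S S' → Pred S' 0ℓ → Pred S 0ℓ
⟦ r ⟧ U a = ∃ λ B → rel r a B × All U B

module _ {S S' : Set} where

  ⟦⟧-mono : (r : UpRel S S') {U V : Pred S' 0ℓ} → U ⊆ V → ⟦ r ⟧ U ⊆ ⟦ r ⟧ V
  ⟦⟧-mono r U⊆V (B , aRB , B⊆U) = B , aRB , All.map U⊆V B⊆U

  ⟦⟧-resp-≈R : {r r' : UpRel S S'} → r ≈R r' → {U : Pred S' 0ℓ} → ⟦ r ⟧ U ≐ ⟦ r' ⟧ U
  ⟦⟧-resp-≈R r≈r' = (λ { {a} (B , aRB , B⊆U) → B , proj₁ (r≈r' a B) aRB , B⊆U })
                  , (λ { {a} (B , aRB , B⊆U) → B , proj₂ (r≈r' a B) aRB , B⊆U })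

  ⟦⟧-∈ : (r : UpRel S S') {C : List S'} → ⟦ r ⟧ (_∈ C) ≐ (λ a → rel r a C)
  ⟦⟧-∈ r {C} = (λ (B , aRB , B⊆C) → upper r aRB (All.lookup B⊆C))
             , (λ aRC → C , aRC , All.tabulate (λ c∈C → c∈C))

module _ {S S' S'' : Set} (s : UpRel S' S'') where

  ⟦⟧-All-merge : {U : Pred S'' 0ℓ} {B : List S'} → All (⟦ s ⟧ U) B →
                 ∃ λ C → All (λ b → rel s b C) B × All U C
  ⟦⟧-All-merge [] = [] , [] , []
  ⟦⟧-All-merge ((C₁ , bSC₁ , C₁⊆U) ∷ B⊆⟦s⟧U) =
    let C₂ , BSC₂ , C₂⊆U = ⟦⟧-All-merge B⊆⟦s⟧U
    in  C₁ ++ C₂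
      , upper s bSC₁ ∈-++⁺ˡ ∷ All.map (λ bSC → upper s bSC (∈-++⁺ʳ C₁)) BSC₂
      , ++⁺ C₁⊆U C₂⊆U

  ⟦⟧-· : (r : UpRel S S') {U : Pred S'' 0ℓ} → ⟦ s · r ⟧ U ≐ ⟦ r ⟧ (⟦ s ⟧ U)
  ⟦⟧-· r = (λ (C , (B , aRB , BSC) , C⊆U) → B , aRB , All.map (λ bSC → C , bSC , C⊆U) BSC)
         , (λ (B , aRB , B⊆⟦s⟧U) →
              let C , BSC , C⊆U = ⟦⟧-All-merge B⊆⟦s⟧U in C , (B , aRB , BSC) , C⊆U)

⟦⟧-absorb : ∀ {S S' S''} (r : UpRel S S') (s : UpRel S' S'') {t : UpRel S S''} →
            s · r ≈R t → {U : Pred S'' 0ℓ} → ⟦ r ⟧ (⟦ s ⟧ U) ≐ ⟦ t ⟧ U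
⟦⟧-absorb r s {t} sr≈t {U} =
    (λ z → proj₁ ⟦s·r⟧≐⟦t⟧ (proj₂ (⟦⟧-· s r {U}) z))
  , (λ z → proj₁ (⟦⟧-· s r {U}) (proj₂ ⟦s·r⟧≐⟦t⟧ z))
  where ⟦s·r⟧≐⟦t⟧ = ⟦⟧-resp-≈R {r = s · r} {r' = t} sr≈t {U}

module _ (𝕃 : DLat) where
  open DLat 𝕃

  Directed⇒∃All : ∀ {A : Set} {I} {D : I → L} → Directed I D →
                  (P : I → Pred A 0ℓ) → (∀ {i k} → D i ≤ D k → P i ⊆ P k) →
                  ∀ {G} → All (λ g → ∃ λ i → P i g) G → ∃ λ k → All (P k) G
  Directed⇒∃All (i₀ , _) P P-mono [] = i₀ , []
  Directed⇒∃All d@(_ , ub) P P-mono ((i , g∈Pi) ∷ G⊆⋃P) =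
    let j , G⊆Pj = Directed⇒∃All d P P-mono G⊆⋃P
        k , i≤k , j≤k = ub i j
    in  k , P-mono i≤k g∈Pi ∷ All.map (P-mono j≤k) G⊆Pj

  finite-subsets-directed : ∀ {A : Set} (f : List A → L) →
                            (∀ {B C} → (∀ {a} → a ∈ B → a ∈ C) → f B ≤ f C) →
                            (U : Pred A 0ℓ) → Directed (Σ (List A) (All U)) (λ B → f (proj₁ B))
  finite-subsets-directed f f-mono U =
    ([] , []) , λ (B₁ , B₁⊆U) (B₂ , B₂⊆U) →
      (B₁ ++ B₂ , ++⁺ B₁⊆U B₂⊆U) , f-mono ∈-++⁺ˡ , f-mono (∈-++⁺ʳ B₁)

-- Predicates are compared through their Φ-images, so U and Φ U become equal: this
-- presents the image of Φ without a quotient.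
module IdempotentLattice (X : Idempotent SEnt) where
  open Idempotent X renaming (obj to S; idem to e)

  Φ : Pred S 0ℓ → Pred S 0ℓ
  Φ = ⟦ e ⟧

  Φ-mono : ∀ {U V} → U ⊆ V → Φ U ⊆ Φ V
  Φ-mono = ⟦⟧-mono e

  Φ-idem : ∀ {U} → Φ (Φ U) ≐ Φ U
  Φ-idem = ⟦⟧-absorb e e {e} isIdem

  ⊆Φ⇒Φ⊆ : ∀ {U V} → U ⊆ Φ V → Φ U ⊆ Φ V
  ⊆Φ⇒Φ⊆ U⊆ΦV z = proj₁ Φ-idem (Φ-mono U⊆ΦV z)

  Φ⊆⇒Φ⊆ : ∀ {U V} → Φ U ⊆ V → Φ U ⊆ Φ V
  Φ⊆⇒Φ⊆ ΦU⊆V z = Φ-mono ΦU⊆V (proj₂ Φ-idem z)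

  lattice : DLat
  lattice = record
    { L = Pred S 0ℓ
    ; _≤_ = λ U V → Φ U ⊆ Φ V
    ; ≤-refl = λ z → z
    ; ≤-trans = λ U≤V V≤W z → V≤W (U≤V z)
    ; ⋁ = λ I D _ → ⋃ I (λ i → Φ (D i))
    ; ⋁-ub = λ _ i → Φ⊆⇒Φ⊆ (λ z → i , z)
    ; ⋁-least = λ _ U D≤U → ⊆Φ⇒Φ⊆ (λ (i , z) → D≤U i z)
    ; ⊥ = ∅
    ; ⊥-least = λ _ → ⊆Φ⇒Φ⊆ (λ ())
    ; _∨_ = λ U V → Φ U ∪ Φ V
    ; ∨-ubˡ = λ _ _ → Φ⊆⇒Φ⊆ inj₁
    ; ∨-ubʳ = λ _ _ → Φ⊆⇒Φ⊆ inj₂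
    ; ∨-least = λ _ _ _ U≤W V≤W → ⊆Φ⇒Φ⊆ (λ { (inj₁ z) → U≤W z ; (inj₂ z) → V≤W z }) }

  open DLat lattice

  ≐⇒≈ : ∀ {U V} → U ≐ V → U ≈ V
  ≐⇒≈ (U⊆V , V⊆U) = Φ-mono U⊆V , Φ-mono V⊆U

  Φ-≈ : ∀ {U} → Φ U ≈ U
  Φ-≈ = Φ-idem

  ≈-trans : ∀ {U V W} → U ≈ V → V ≈ W → U ≈ W
  ≈-trans (U≤V , V≤U) (V≤W , W≤V) = ≤-trans U≤V V≤W , ≤-trans W≤V V≤U

  ⟦⟧-⋁ : ∀ {T} (r : UpRel T S) {I D} (d : Directed I D) →
         ⟦ r ⟧ (⋁ I D d) ⊆ ⋃ I (λ i → ⟦ r ⟧ (Φ (D i)))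
  ⟦⟧-⋁ r {D = D} d (C , aRC , C⊆⋁) =
    let k , C⊆ΦDk = Directed⇒∃All lattice d (λ i → Φ (D i)) (λ Di≤Dk → Di≤Dk) C⊆⋁
    in  k , C , aRC , C⊆ΦDk

  Φ-⋁ : ∀ {I D} (d : Directed I D) → Φ (⋁ I D d) ⊆ ⋃ I (λ i → Φ (D i))
  Φ-⋁ d z = let i , w = ⟦⟧-⋁ e d z in i , proj₁ Φ-idem w

  β : List S → Pred S 0ℓ
  β C = _∈ C

  β-mono : ∀ {B C} → (∀ {a} → a ∈ B → a ∈ C) → β B ≤ β C
  β-mono B⊆C = Φ-mono B⊆C

  β≤ : ∀ {C U} → All (Φ U) C → β C ≤ U
  β≤ C⊆ΦU = ⊆Φ⇒Φ⊆ (All.lookup C⊆ΦU)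

  finite-subsets-dir : ∀ U → Directed (Σ (List S) (All U)) (λ C → β (proj₁ C))
  finite-subsets-dir = finite-subsets-directed lattice β β-mono

  ≤-⋁finite-subsets : ∀ U → U ≤ ⋁ _ _ (finite-subsets-dir U)
  ≤-⋁finite-subsets U = Φ⊆⇒Φ⊆ (λ (C , aeC , C⊆U) → (C , C⊆U) , proj₂ (⟦⟧-∈ e) aeC)

  -- β F ≪ U means that β F lies below a finite subset of Φ U; asking for F ⊆ Φ U
  -- instead would be wrong, since e need not be reflexive.
  _≺_ : List S → Pred S 0ℓ → Set
  F ≺ U = ∃ λ G → All (Φ U) G × β F ≤ β G

  approx-dir : ∀ U → Directed (Σ (List S) (_≺ U)) (λ F → β (proj₁ F))
  approx-dir U =
    ([] , [] , [] , (λ {_} z → z)) , λ (F₁ , G₁ , G₁⊆ΦU , F₁≤G₁) (F₂ , G₂ , G₂⊆ΦU , F₂≤G₂) →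
        (G₁ ++ G₂ , G₁ ++ G₂ , ++⁺ G₁⊆ΦU G₂⊆ΦU , (λ {_} z → z))
      , ≤-trans F₁≤G₁ (β-mono ∈-++⁺ˡ) , ≤-trans F₂≤G₂ (β-mono (∈-++⁺ʳ G₁))

  approx : ∀ U → ⋁ _ _ (approx-dir U) ≈ U
  approx U = ⋁-least (approx-dir U) U (λ (F , G , G⊆ΦU , F≤G) → ≤-trans F≤G (β≤ G⊆ΦU))
           , Φ⊆⇒Φ⊆ (λ z → let C , aeC , C⊆ΦU = proj₂ Φ-idem z
                          in  (C , C , C⊆ΦU , (λ {_} z → z)) , proj₂ (⟦⟧-∈ e) aeC)

  ≺⇒≪ : ∀ {F U} → F ≺ U → β F ≪ U
  ≺⇒≪ (G , G⊆ΦU , F≤G) I D d U≤⋁ =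
    let k , G⊆ΦDk = Directed⇒∃All lattice d (λ i → Φ (D i)) (λ Di≤Dk → Di≤Dk)
                                   (All.map (λ z → Φ-⋁ d (U≤⋁ z)) G⊆ΦU)
    in  k , ≤-trans F≤G (β≤ G⊆ΦDk)

  ≪⇒≺ : ∀ {F U} → β F ≪ U → F ≺ U
  ≪⇒≺ {U = U} F≪U =
    let (F' , G , G⊆ΦU , F'≤G) , F≤F' = F≪U _ _ (approx-dir U) (proj₂ (approx U))
    in  G , G⊆ΦU , ≤-trans F≤F' F'≤G

  Lat : ContLattice
  Lat = record
    { dlat = lattice ; Basis = List S ; β = β ; _≺_ = _≺_
    ; ≺⇒≪ = ≺⇒≪ ; ≪⇒≺ = ≪⇒≺ ; approx-dir = approx-dir ; approx = approx }

open IdempotentLattice using (Lat)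

module SplitHomAction {A B : Idempotent SEnt} (f : SplitHom SEnt B A) where
  private
    module A = IdempotentLattice A
    module B = IdempotentLattice B
  open SplitHom f

  absorbˡ : ∀ {U} → ⟦ hom ⟧ (A.Φ U) ≐ ⟦ hom ⟧ U
  absorbˡ = ⟦⟧-absorb hom (Idempotent.idem A) {hom} left

  absorbʳ : ∀ {U} → B.Φ (⟦ hom ⟧ U) ≐ ⟦ hom ⟧ U
  absorbʳ = ⟦⟧-absorb (Idempotent.idem B) hom {hom} right

  ⟦⟧-monotone : Monotone (Lat A) (Lat B) ⟦ hom ⟧
  ⟦⟧-monotone U≤V z =
    proj₂ absorbʳ (proj₁ absorbˡ (⟦⟧-mono hom U≤V (proj₂ absorbˡ (proj₁ absorbʳ z))))

  scottCont : ScottCont (Lat A) (Lat B)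
  scottCont = record
    { fun = ⟦ hom ⟧
    ; mono = ⟦⟧-monotone
    ; pres-⋁ = λ d → B.Φ-mono (λ z → let i , w = A.⟦⟧-⋁ hom d z
                                     in  i , proj₂ absorbʳ (proj₁ absorbˡ w)) }

open SplitHomAction using (scottCont)

Lat-functor : Functor (op (Split SEnt)) ContLatScott
Lat-functor = record
  { F₀ = Lat
  ; F₁ = scottCont
  ; F-resp-≈ = λ {_} {B} {f} {g} f≈g U →
      let ⟦f⟧≐⟦g⟧ = ⟦⟧-resp-≈R {r = SplitHom.hom f} {r' = SplitHom.hom g} f≈g {U}
      in  IdempotentLattice.≐⇒≈ B ⟦f⟧≐⟦g⟧
  ; F-id = λ {A} U → IdempotentLattice.Φ-idem A {U}
  ; F-∘ = λ {_} {_} {K} {f} {g} U →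
      IdempotentLattice.≐⇒≈ K (⟦⟧-· (SplitHom.hom f) (SplitHom.hom g) {U}) }

module Fullness {A B : Idempotent SEnt} (φ : ScottCont (Lat A) (Lat B)) where
  private
    module A = IdempotentLattice A
    module B = IdempotentLattice B
    module LB = ContLattice (Lat B)
  open ScottCont φ

  reify : UpRel (Idempotent.obj B) (Idempotent.obj A)
  reify = record
    { rel = λ b C → B.Φ (fun (A.β C)) b
    ; upper = λ z C⊆C' → mono (A.β-mono C⊆C') z }

  -- The reverse inclusion is Scott continuity of φ at U, the directed join of its
  -- finite subsets.
  ⟦reify⟧ : ∀ U → ⟦ reify ⟧ U ≐ B.Φ (fun U)
  ⟦reify⟧ U =
      (λ (C , bRC , C⊆U) → mono (A.Φ-mono (All.lookup C⊆U)) bRC)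
    , (λ z → let d = A.finite-subsets-dir U
                 z' = pres-⋁ d (mono (A.≤-⋁finite-subsets U) z)
                 (C , C⊆U) , w = B.Φ-⋁ (mapDir (Lat A) (Lat B) mono d) z'
             in  C , w , C⊆U)

  reify-≈ : ∀ U → ⟦ reify ⟧ U LB.≈ fun U
  reify-≈ U = B.≈-trans (B.≐⇒≈ (⟦reify⟧ U)) B.Φ-≈

  reify-hom : SplitHom SEnt B A
  reify-hom = record
    { hom = reify
    ; left = λ b C →
        let relC≈βC = A.≈-trans (A.≐⇒≈ (swap (⟦⟧-∈ (Idempotent.idem A)))) A.Φ-≈
        in  (λ z → mono (proj₁ relC≈βC) (proj₁ (⟦reify⟧ _) z))
          , (λ z → proj₂ (⟦reify⟧ _) (mono (proj₂ relC≈βC) z))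
    ; right = λ b C → proj₁ B.Φ-idem , proj₂ B.Φ-idem }

module _ {A B : Idempotent SEnt} where
  private
    module A = IdempotentLattice A
    module LB = ContLattice (Lat B)

  -- Testing against the basic elements A.β C recovers the relation itself.
  scottCont-reflects-≤ : (f g : SplitHom SEnt B A) →
                         (∀ U → ⟦ SplitHom.hom f ⟧ U LB.≤ ⟦ SplitHom.hom g ⟧ U) →
                         ∀ b C → rel (SplitHom.hom f) b C → rel (SplitHom.hom g) b C
  scottCont-reflects-≤ f g f≤g b C bfC =
    proj₁ (⟦⟧-∈ (SplitHom.hom g))
      (proj₁ (SplitHomAction.absorbʳ g)
        (f≤g (A.β C) (proj₂ (SplitHomAction.absorbʳ f) (proj₂ (⟦⟧-∈ (SplitHom.hom f)) bfC))))

  scottCont-faithful : (f g : SplitHom SEnt B A) →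
                       (∀ U → ⟦ SplitHom.hom f ⟧ U LB.≈ ⟦ SplitHom.hom g ⟧ U) →
                       SplitHom.hom f ≈R SplitHom.hom g
  scottCont-faithful f g f≈g b C = scottCont-reflects-≤ f g (λ U → proj₁ (f≈g U)) b C
                                 , scottCont-reflects-≤ g f (λ U → proj₂ (f≈g U)) b C

module ContLatticeProperties (C : ContLattice) where
  open ContLattice C

  ≪⇒≤ : ∀ {x y} → x ≪ y → x ≤ y
  ≪⇒≤ {y = y} x≪y = proj₂ (x≪y ⊤ (λ _ → y) d (⋁-ub d tt))
    where
    d : Directed ⊤ (λ _ → y)
    d = tt , λ _ _ → tt , ≤-refl , ≤-refl

  ≤-≪-trans : ∀ {x y z} → x ≤ y → y ≪ z → x ≪ z
  ≤-≪-trans x≤y y≪z I D d z≤⋁ = let i , y≤Di = y≪z I D d z≤⋁ in i , ≤-trans x≤y y≤Di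

  ≺-mono : ∀ {b x y} → b ≺ x → x ≤ y → b ≺ y
  ≺-mono b≺x x≤y = ≪⇒≺ (λ I D d y≤⋁ → ≺⇒≪ b≺x I D d (≤-trans x≤y y≤⋁))

  ≺⇒≤ : ∀ {b x} → b ≺ x → β b ≤ x
  ≺⇒≤ b≺x = ≪⇒≤ (≺⇒≪ b≺x)

  approx-least : ∀ {x y} → (∀ {b} → b ≺ x → β b ≤ y) → x ≤ y
  approx-least {x} b≺x⇒b≤y =
    ≤-trans (proj₂ (approx x)) (⋁-least _ _ (λ (b , b≺x) → b≺x⇒b≤y b≺x))

  module _ (x : L) where
    Approx² : Set
    Approx² = Σ (Σ Basis (_≺ x)) λ c → Σ Basis (_≺ β (proj₁ c))

    approx²-dir : Directed Approx² (λ (_ , d , _) → β d)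
    approx²-dir =
      (c₀ , proj₁ (approx-dir (β (proj₁ c₀)))) ,
      λ ((c₁ , c₁≺x) , d₁ , d₁≺c₁) ((c₂ , c₂≺x) , d₂ , d₂≺c₂) →
        let c , c₁≤c , c₂≤c = proj₂ (approx-dir x) (c₁ , c₁≺x) (c₂ , c₂≺x)
            d , d₁≤d , d₂≤d = proj₂ (approx-dir (β (proj₁ c))) (d₁ , ≺-mono d₁≺c₁ c₁≤c)
                                                                (d₂ , ≺-mono d₂≺c₂ c₂≤c)
        in  (c , d) , d₁≤d , d₂≤d
      where c₀ = proj₁ (approx-dir x)

    ≤-⋁approx² : x ≤ ⋁ _ _ approx²-dir
    ≤-⋁approx² = approx-least λ {c} c≺x → approx-least λ {d} d≺c →
                   ⋁-ub approx²-dir ((c , c≺x) , d , d≺c)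

  ≺-interpolate : ∀ {b x} → b ≺ x → ∃ λ c → b ≺ β c × c ≺ x
  ≺-interpolate {x = x} b≺x =
    let ((c , c≺x) , d , d≺c) , b≤d = ≺⇒≪ b≺x _ _ (approx²-dir x) (≤-⋁approx² x)
    in  c , ≪⇒≺ (≤-≪-trans b≤d (≺⇒≪ d≺c)) , c≺x

  ≺-⋁ : ∀ {b I D} (d : Directed I D) → b ≺ ⋁ I D d → ∃ λ i → b ≺ D i
  ≺-⋁ d b≺⋁ =
    let c , b≺c , c≺⋁ = ≺-interpolate b≺⋁
        i , c≤Di = ≺⇒≪ c≺⋁ _ _ d ≤-refl
    in  i , ≺-mono b≺c c≤Di

  joinβ : List Basis → L
  joinβ [] = ⊥
  joinβ (b ∷ B) = β b ∨ joinβ B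

  joinβ-ub : ∀ {b B} → b ∈ B → β b ≤ joinβ B
  joinβ-ub (here refl) = ∨-ubˡ _ _
  joinβ-ub (there b∈B) = ≤-trans (joinβ-ub b∈B) (∨-ubʳ _ _)

  joinβ-least : ∀ {B u} → All (λ b → β b ≤ u) B → joinβ B ≤ u
  joinβ-least [] = ⊥-least _
  joinβ-least (b≤u ∷ B≤u) = ∨-least _ _ _ b≤u (joinβ-least B≤u)

  joinβ-mono : ∀ {B B'} → (∀ {b} → b ∈ B → b ∈ B') → joinβ B ≤ joinβ B'
  joinβ-mono B⊆B' = joinβ-least (All.tabulate (λ b∈B → joinβ-ub (B⊆B' b∈B)))

module BasisIdempotent (C : ContLattice) where
  open ContLattice C
  open ContLatticeProperties C

  entails : UpRel Basis Basis
  entails = record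
    { rel = λ b B → b ≺ joinβ B
    ; upper = λ b≺B B⊆B' → ≺-mono b≺B (joinβ-mono B⊆B') }

  ≺-⟦entails⟧ : ∀ {b x} → b ≺ x → ⟦ entails ⟧ (_≺ x) b
  ≺-⟦entails⟧ b≺x = let c , b≺c , c≺x = ≺-interpolate b≺x
                    in  [ c ] , ≺-mono b≺c (∨-ubˡ _ _) , c≺x ∷ []

  entails-idem : entails · entails ≈R entails
  entails-idem b C = (λ (B , b≺B , B≺C) → ≺-mono b≺B (joinβ-least (All.map ≺⇒≤ B≺C)))
                   , ≺-⟦entails⟧

  idempotent : Idempotent SEnt
  idempotent = record { obj = Basis ; idem = entails ; isIdem = entails-idem }

  private
    module X = IdempotentLattice idempotent
    module LX = ContLattice (Lat idempotent)

  finite-joins-dir : ∀ U → Directed (Σ (List Basis) (All U)) (λ B → joinβ (proj₁ B))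
  finite-joins-dir = finite-subsets-directed dlat joinβ joinβ-mono

  ⋁β : Pred Basis 0ℓ → L
  ⋁β U = ⋁ _ _ (finite-joins-dir U)

  ≺-⋁β : ∀ U → (_≺ ⋁β U) ≐ X.Φ U
  ≺-⋁β U = (λ b≺U → let (B , B⊆U) , b≺B = ≺-⋁ (finite-joins-dir U) b≺U
                     in  B , b≺B , B⊆U)
          , (λ (B , b≺B , B⊆U) → ≺-mono b≺B (⋁-ub (finite-joins-dir U) (B , B⊆U)))

  ⋁β-mono : ∀ {U V} → U LX.≤ V → ⋁β U ≤ ⋁β V
  ⋁β-mono {U} {V} U≤V =
    approx-least λ b≺U → ≺⇒≤ (proj₂ (≺-⋁β V) (U≤V (proj₁ (≺-⋁β U) b≺U)))

  ⋁β-scott : ScottCont (Lat idempotent) C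
  ⋁β-scott = record
    { fun = ⋁β
    ; mono = ⋁β-mono
    ; pres-⋁ = λ {D = D} d → approx-least λ b≺⋁ →
        let i , b∈ΦDi = X.Φ-⋁ d (proj₁ (≺-⋁β _) b≺⋁)
        in  ≤-trans (≺⇒≤ (proj₂ (≺-⋁β (D i)) b∈ΦDi)) (⋁-ub _ i) }

  ≺-scott : ScottCont C (Lat idempotent)
  ≺-scott = record
    { fun = λ x → _≺ x
    ; mono = λ x≤y → X.Φ-mono (λ b≺x → ≺-mono b≺x x≤y)
    ; pres-⋁ = λ d → X.Φ-mono (λ b≺⋁ → let i , b≺Di = ≺-⋁ d b≺⋁
                                        in  i , ≺-⟦entails⟧ b≺Di) }

  iso : Iso ContLatScott (Lat idempotent) C
  iso = record
    { to = ⋁β-scott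
    ; from = ≺-scott
    ; from∘to = λ U → X.≈-trans (X.≐⇒≈ (≺-⋁β U)) X.Φ-≈
    ; to∘from = λ x → ⋁-least _ _ (λ (B , B≺x) → joinβ-least (All.map ≺⇒≤ B≺x))
                    , approx-least (λ {c} c≺x → ≤-trans (joinβ-ub {B = [ c ]} (here refl))
                                                         (⋁-ub _ ([ c ] , c≺x ∷ []))) }

theorem4p6 : DuallyEquivalent (Split SEnt) ContLatScott
theorem4p6 = Lat-functor , record
  { full = λ φ → Fullness.reify-hom φ , Fullness.reify-≈ φ
  ; faithful = scottCont-faithful
  ; essSurj = λ C → BasisIdempotent.idempotent C , BasisIdempotent.iso C }
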